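{- Every labelled sequent derivable in the calculus $\mathsf{G3Ldm}$ is valid.
   Context: Fix a finite set of agents $Ag=\{1,\dots,n\}$ and a countable set $Var$ of propositional variables. $\mathcal{L}_{\mathsf{Ldm}}$ (negation normal form): $\phi ::= p \mid \overline{p} \mid \phi\wedge\phi \mid \phi\vee\phi \mid \Box\phi \mid \Diamond\phi \mid [i]\phi \mid \langle i\rangle\phi$, $p\in Var$, $i\in Ag$. A $\mathsf{Tstit}$-model is $(W,\mathcal{R}_\Box,\{\mathcal{R}_i\}_{i\in Ag},\mathcal{R}_{Ag},\mathcal{R}_{\mathsf G},\mathcal{R}_{\mathsf H},V)$ with $W\ne\emptyset$, $V:Var\to\mathcal P(W)$, $\mathcal{R}_\Box,\mathcal{R}_i,\mathcal{R}_{Ag}$ equivalence relations, and (C1) $\mathcal{R}_i\subseteq\mathcal{R}_\Box$; (C2) for all $u_1,\dots,u_n$ pairwise $\mathcal{R}_\Box$-related, $\bigcap_i\mathcal{R}_i(u_i)\neq\emptyset$ (where $\mathcal R(w)=\{v:(w,v)\in\mathcal R\}$); (C3) $\mathcal{R}_{Ag}(w)=\bigcap_{i}\mathcal{R}_i(w)$; $\mathcal{R}_{\mathsf G}$ transitive and serial, $\mathcal{R}_{\mathsf H}$ its converse; (C4) if $\mathcal{R}_{\mathsf G}wu,\mathcal{R}_{\mathsf G}wv$ then $\mathcal{R}_{\mathsf G}uv$ or $u=v$ or $\mathcal{R}_{\mathsf G}vu$; (C5) same for $\mathcal{R}_{\mathsf H}$; (C6) $\mathcal{R}_{\mathsf G}\circ\mathcal{R}_\Box\subseteq\mathcal{R}_{Ag}\circ\mathcal{R}_{\mathsf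 G}$; (C7) $u\in\mathcal{R}_\Box(w)$ implies $u\notin\mathcal{R}_{\mathsf G}(w)$. Satisfaction: $w\models p$ iff $w\in V(p)$; $w\models\overline p$ iff $w\notin V(p)$; $\wedge,\vee$ classical; $\Box$/$\Diamond$ are universal/existential over $\mathcal{R}_\Box(w)$; $[i]$/$\langle i\rangle$ over $\mathcal{R}_i(w)$. Labelled sequents: $\Gamma ::= x:\phi \mid \Gamma,\Gamma \mid \mathcal{R}_\alpha xy,\Gamma$ (multisets), with labels from a countable set $L$, $\phi\in\mathcal L_{\mathsf{Ldm}}$, $\alpha\in\{\Box\}\cup Ag$. Rules of $\mathsf{G3Ldm}$ (one-sided): (id) $\Gamma,w:p,w:\overline p$ is an axiom; ($\wedge$) from $\Gamma,w:\phi$ and $\Gamma,w:\psi$ infer $\Gamma,w:\phi\wedge\psi$; ($\vee$) from $\Gamma,w:\phi,w:\psi$ infer $\Gamma,w:\phi\vee\psi$; ($\Box$) from $\Gamma,\mathcal R_\Box wv,v:\phi$ infer $\Gamma,w:\Box\phi$; ($\Diamond$) from $\Gamma,\mathcal R_\Box wu,w:\Diamond\phi,u:\phi$ infer $\Gamma,\mathcal R_\Box wu,w:\Diamond\phi$; ($[i]$) from $\Gamma,\mathcal R_i wv,v:\phi$ infer $\Gamma,w:[i]\phi$; ($\langle i\rangle$) from $\Gamma,\mathcal R_iwu,w:\langle i\rangle\phi,u:\phi$ infer $\Gamma,\mathcal R_iwu,w:\langle i\rangle\phi$; ($\mathsf{refl}_\Box$) from $\mathcal R_\Box ww,\Gamma$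 infer $\Gamma$; ($\mathsf{refl}_{[i]}$) from $\mathcal R_iww,\Gamma$ infer $\Gamma$; ($\mathsf{IOA}$) from $\mathcal R_\Box wu_1,\dots,\mathcal R_\Box wu_n,\mathcal R_1u_1v,\dots,\mathcal R_nu_nv,\Gamma$ infer $\mathcal R_\Box wu_1,\dots,\mathcal R_\Box wu_n,\Gamma$; ($\mathsf{eucl}_\Box$) from $\mathcal R_\Box wu,\mathcal R_\Box wv,\mathcal R_\Box uv,\Gamma$ infer $\mathcal R_\Box wu,\mathcal R_\Box wv,\Gamma$; ($\mathsf{br}_{[i]}$) from $\mathcal R_\Box wu,\mathcal R_iwu,\Gamma$ infer $\mathcal R_iwu,\Gamma$; ($\mathsf{eucl}_{[i]}$) from $\mathcal R_iwu,\mathcal R_iwv,\mathcal R_iuv,\Gamma$ infer $\mathcal R_iwu,\mathcal R_iwv,\Gamma$. In ($\Box$), ($[i]$), ($\mathsf{IOA}$) the label $v$ must not occur in the conclusion. The calculus also contains, for each rule where a substitution of labels duplicates active relational atoms, the instance with the duplicates contracted. Interpretation: for a $\mathsf{Tstit}$-model $M$ and a map $I:L\to W$, a sequent $\Gamma$ is satisfied in $M$ under $I$ iff, whenever $\mathcal R_\alpha I(x)I(y)$ holds in $M$ for every relational atom $\mathcal R_\alpha xy$ in $\Gamma$, there is some $z:\phi$ in $\Gamma$ with $M,I(z)\models\phi$. $\Gamma$ is valid iff it is satisfied in every such model under every $I$. -}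

module Defs where

open import Data.Nat using (ℕ)
import Data.Nat as ℕ
open import Data.Fin using (Fin)
import Data.Fin as F
open import Data.Bool using (Bool; true; false)
open import Data.List using (List; []; _∷_; _++_; map; deduplicate; tabulate)
open import Data.List.Relation.Unary.All using (All)
open import Data.List.Relation.Unary.Any using (Any)
open import Data.List.Relation.Binary.Permutation.Propositional using (_↭_)
open import Data.Product using (Σ; ∃; _×_; _,_)
open import Data.Sum using (_⊎_)
open import Data.Unit using (⊤)
open import Data.Empty using (⊥)
open import Relation.Nullary using (¬_; Dec; yes; no)
open import Relation.Binary.Structures using (IsEquivalence)
open import Relation.Binary.PropositionalEquality using (_≡_; refl)

Var : Set
Var = ℕ

Label : Set
Label = ℕ

-- Agents: Ag = Fin n.
-- Formulas of L_Ldm in negation normal form.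
data Fm (n : ℕ) : Set where
  var  : Var → Fm n
  nvar : Var → Fm n
  _∧ᶠ_ : Fm n → Fm n → Fm n
  _∨ᶠ_ : Fm n → Fm n → Fm n
  □ᶠ   : Fm n → Fm n
  ◇ᶠ   : Fm n → Fm n
  [_]ᶠ : Fin n → Fm n → Fm n
  ⟨_⟩ᶠ : Fin n → Fm n → Fm n

data Idx (n : ℕ) : Set where
  box : Idx n
  ag  : Fin n → Idx n

record RA (n : ℕ) : Set where
  constructor mkRA
  field
    idx : Idx n
    src : Label
    tgt : Label

data Item (n : ℕ) : Set where
  _∶_ : Label → Fm n → Item n
  rel : RA n → Item n

-- Sequents (multisets, represented as lists; the calculus is closed under permutation)
Seq : ℕ → Set
Seq n = List (Item n)

_≟ᵢ_ : ∀ {n} (a b : Idx n) → Dec (a ≡ b)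
box ≟ᵢ box = yes refl
box ≟ᵢ ag _ = no (λ ())
ag _ ≟ᵢ box = no (λ ())
ag i ≟ᵢ ag j with i F.≟ j
... | yes refl = yes refl
... | no i≢j = no (λ { refl → i≢j refl })

_≟ʳ_ : ∀ {n} (a b : RA n) → Dec (a ≡ b)
(mkRA α x y) ≟ʳ (mkRA β x' y') with α ≟ᵢ β | x ℕ.≟ x' | y ℕ.≟ y'
... | yes refl | yes refl | yes refl = yes refl
... | no ne | _ | _ = no (λ { refl → ne refl })
... | yes _ | no ne | _ = no (λ { refl → ne refl })
... | yes _ | yes _ | no ne = no (λ { refl → ne refl })

-- the active relational atoms of a rule instance: either as they are (c = false)
-- or with duplicates contracted (c = true)
ctr : ∀ {n} → Bool → List (RA n) → List (RA n)
ctr false xs = xs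
ctr true  xs = deduplicate _≟ʳ_ xs

rels : ∀ {n} → List (RA n) → Seq n
rels = map rel

Rb : ∀ {n} → Label → Label → RA n
Rb x y = (mkRA box x y)

Ri : ∀ {n} → Fin n → Label → Label → RA n
Ri i x y = mkRA (ag i) x y

_occursIn_ : ∀ {n} → Label → Item n → Set
x occursIn (y ∶ _) = x ≡ y
x occursIn rel (mkRA _ a b) = x ≡ a ⊎ x ≡ b

Fresh : ∀ {n} → Label → Seq n → Set
Fresh v Γ = All (λ it → ¬ (v occursIn it)) Γ

data G3 {n : ℕ} : Seq n → Set where
  id    : ∀ Γ w p → G3 (w ∶ var p ∷ w ∶ nvar p ∷ Γ)
  ∧r    : ∀ Γ w φ ψ → G3 (w ∶ φ ∷ Γ) → G3 (w ∶ ψ ∷ Γ) → G3 (w ∶ (φ ∧ᶠ ψ) ∷ Γ)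
  ∨r    : ∀ Γ w φ ψ → G3 (w ∶ φ ∷ w ∶ ψ ∷ Γ) → G3 (w ∶ (φ ∨ᶠ ψ) ∷ Γ)
  □r    : ∀ Γ w v φ → Fresh v (w ∶ □ᶠ φ ∷ Γ)
          → G3 (rel (Rb w v) ∷ v ∶ φ ∷ Γ) → G3 (w ∶ □ᶠ φ ∷ Γ)
  ◇r    : ∀ Γ w u φ → G3 (rel (Rb w u) ∷ w ∶ ◇ᶠ φ ∷ u ∶ φ ∷ Γ)
          → G3 (rel (Rb w u) ∷ w ∶ ◇ᶠ φ ∷ Γ)
  [i]r  : ∀ Γ i w v φ → Fresh v (w ∶ [ i ]ᶠ φ ∷ Γ)
          → G3 (rel (Ri i w v) ∷ v ∶ φ ∷ Γ) → G3 (w ∶ [ i ]ᶠ φ ∷ Γ)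
  ⟨i⟩r  : ∀ Γ i w u φ → G3 (rel (Ri i w u) ∷ w ∶ ⟨ i ⟩ᶠ φ ∷ u ∶ φ ∷ Γ)
          → G3 (rel (Ri i w u) ∷ w ∶ ⟨ i ⟩ᶠ φ ∷ Γ)
  refl□ : ∀ Γ w → G3 (rel (Rb w w) ∷ Γ) → G3 Γ
  refl[i] : ∀ Γ i w → G3 (rel (Ri i w w) ∷ Γ) → G3 Γ
  IOA   : ∀ Γ (c : Bool) w v (u : Fin n → Label)
          → Fresh v (rels (ctr c (tabulate (λ i → Rb w (u i)))) ++ Γ)
          → G3 (rels (ctr c (tabulate (λ i → Rb w (u i)) ++ tabulate (λ i → Ri i (u i) v))) ++ Γ)
          → G3 (rels (ctr c (tabulate (λ i → Rb w (u i)))) ++ Γ)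
  eucl□ : ∀ Γ (c : Bool) w u v
          → G3 (rels (ctr c (Rb w u ∷ Rb w v ∷ Rb u v ∷ [])) ++ Γ)
          → G3 (rels (ctr c (Rb w u ∷ Rb w v ∷ [])) ++ Γ)
  br[i] : ∀ Γ i w u
          → G3 (rel (Rb w u) ∷ rel (Ri i w u) ∷ Γ)
          → G3 (rel (Ri i w u) ∷ Γ)
  eucl[i] : ∀ Γ (c : Bool) i w u v
          → G3 (rels (ctr c (Ri i w u ∷ Ri i w v ∷ Ri i u v ∷ [])) ++ Γ)
          → G3 (rels (ctr c (Ri i w u ∷ Ri i w v ∷ [])) ++ Γ)
  perm  : ∀ Γ Δ → Γ ↭ Δ → G3 Γ → G3 Δ

record Model (n : ℕ) : Set₁ where
  field
    W    : Set
    w₀   : W                       -- W ≠ ∅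
    R□   : W → W → Set
    R    : Fin n → W → W → Set
    RAg  : W → W → Set
    RG   : W → W → Set
    RH   : W → W → Set
    V    : Var → W → Set
    R□-equiv  : IsEquivalence R□
    R-equiv   : ∀ i → IsEquivalence (R i)
    RAg-equiv : IsEquivalence RAg
    C1  : ∀ i w v → R i w v → R□ w v
    C2  : (u : Fin n → W) → (∀ i j → R□ (u i) (u j)) → ∃ λ v → ∀ i → R i (u i) v
    C3₁ : ∀ w v → RAg w v → ∀ i → R i w v
    C3₂ : ∀ w v → (∀ i → R i w v) → RAg w v
    G-trans  : ∀ w u v → RG w u → RG u v → RG w v
    G-serial : ∀ w → ∃ λ v → RG w v
    H-conv₁  : ∀ w v → RH w v → RG v w
    H-conv₂  : ∀ w v → RG v w → RH w v
    C4  : ∀ w u v → RG w u → RG w v → RG u v ⊎ u ≡ v ⊎ RG v u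
    C5  : ∀ w u v → RH w u → RH w v → RH u v ⊎ u ≡ v ⊎ RH v u
    C6  : ∀ w v u → RG w v → R□ v u → ∃ λ z → RAg w z × RG z u
    C7  : ∀ w u → R□ w u → ¬ RG w u

module _ {n : ℕ} (M : Model n) where
  open Model M

  _⊨_ : W → Fm n → Set
  w ⊨ var p = V p w
  w ⊨ nvar p = ¬ V p w
  w ⊨ (φ ∧ᶠ ψ) = w ⊨ φ × w ⊨ ψ
  w ⊨ (φ ∨ᶠ ψ) = w ⊨ φ ⊎ w ⊨ ψ
  w ⊨ □ᶠ φ = ∀ v → R□ w v → v ⊨ φ
  w ⊨ ◇ᶠ φ = ∃ λ v → R□ w v × v ⊨ φ
  w ⊨ [ i ]ᶠ φ = ∀ v → R i w v → v ⊨ φ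
  w ⊨ ⟨ i ⟩ᶠ φ = ∃ λ v → R i w v × v ⊨ φ

  relM : Idx n → W → W → Set
  relM box = R□
  relM (ag i) = R i

  RelHolds : (Label → W) → Item n → Set
  RelHolds I (_ ∶ _) = ⊤
  RelHolds I (rel (mkRA α x y)) = relM α (I x) (I y)

  FmHolds : (Label → W) → Item n → Set
  FmHolds I (z ∶ φ) = I z ⊨ φ
  FmHolds I (rel _) = ⊥

  SatSeq : (Label → W) → Seq n → Set
  SatSeq I Γ = All (RelHolds I) Γ → Any (FmHolds I) Γ

Valid : ∀ {n} → Seq n → Set₁
Valid {n} Γ = (M : Model n) (I : Label → Model.W M) → SatSeq M I Γ

module Submission where

-- We show, by induction on derivations, that a derivable
-- sequent is satisfied under EVERY interpretation I of the labels; each rule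
-- is handled by a local soundness lemma stating that the conclusion is
-- satisfied whenever the premise(s) are.  The lemmas are grouped as follows.
--   * Relational prefixes: a sequent  rels ys ++ Γ  is satisfied under I iff
--     "the atoms ys hold under I" implies "Γ is satisfied under I".  Hence a
--     rule that only adds relational atoms is sound as soon as the atoms of
--     its conclusion entail those of its premise in the model (reflexivity,
--     bridge, euclideanity), or - when the premise mentions a fresh label v -
--     as soon as they can be extended by a value for v (independence of
--     agents, via condition C2).  Contracting duplicate atoms changes nothing.
--   * Fresh labels: satisfaction of Γ is unaffected by re-interpreting a label
--     not occurring in Γ; this gives the eigenvariable rules for □ and [i].
--   * □ and [i] (resp. ◇ and ⟨i⟩) are treated uniformly as the universal
--     (resp. existential) modality of the relation indexed by α ∈ {□} ∪ Ag.
-- Excluded middle is used for the axiom (p ∨ p̄) and the eigenvariable rules.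

open import Defs
open import Data.Nat using (ℕ)
open import Level using (0ℓ)
open import Axiom.ExcludedMiddle using (ExcludedMiddle)

import Data.Nat as ℕ
open import Data.Fin using (Fin)
open import Data.Bool using (true; false)
open import Data.List using (List; []; _∷_; _++_; tabulate)
open import Data.List.Relation.Unary.All using (All; []; _∷_)
import Data.List.Relation.Unary.All.Properties as AllP
open import Data.List.Relation.Unary.Any using (Any; here; there)
import Data.List.Relation.Unary.Any.Properties as AnyP
open import Data.List.Relation.Binary.Permutation.Propositional using (↭-sym)
open import Data.List.Relation.Binary.Permutation.Propositional.Properties
  using (All-resp-↭; Any-resp-↭)
open import Data.Product using (∃; _,_; proj₁; proj₂)
open import Data.Sum using (_⊎_; inj₁; inj₂)
open import Data.Unit using (tt)
open import Data.Empty using (⊥-elim)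
open import Relation.Nullary using (¬_; yes; no)
open import Relation.Binary.Structures using (IsEquivalence)
open import Relation.Binary.PropositionalEquality using (_≡_; refl; sym; subst; subst₂; resp)

ctr-All⁺ : ∀ {n} {P : RA n → Set} c {xs : List (RA n)} → All P xs → All P (ctr c xs)
ctr-All⁺ false h = h
ctr-All⁺ true  h = AllP.deduplicate⁺ _≟ʳ_ h

ctr-All⁻ : ∀ {n} {P : RA n → Set} c (xs : List (RA n)) → All P (ctr c xs) → All P xs
ctr-All⁻ false xs h = h
ctr-All⁻ {P = P} true xs h = AllP.deduplicate⁻ _≟ʳ_ (resp P) xs h

modality : ∀ {n} → Idx n → Fm n → Fm n
modality box    φ = □ᶠ φ
modality (ag i) φ = [ i ]ᶠ φ

possibility : ∀ {n} → Idx n → Fm n → Fm n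
possibility box    φ = ◇ᶠ φ
possibility (ag i) φ = ⟨ i ⟩ᶠ φ

-- The atoms of an IOA instance: R_□ w u_i for every agent i (the choices
-- u_i available at w), and R_i u_i v (v lies in the choice of every agent).
choicesAt : ∀ {n} → Label → (Fin n → Label) → List (RA n)
choicesAt w u = tabulate λ i → Rb w (u i)

meetingAt : ∀ {n} → (Fin n → Label) → Label → List (RA n)
meetingAt u v = tabulate λ i → Ri i (u i) v

module Soundness {n : ℕ} (em : ExcludedMiddle 0ℓ) (M : Model n) where
  open Model M

  relM-equiv : ∀ α → IsEquivalence (relM M α)
  relM-equiv box    = R□-equiv
  relM-equiv (ag i) = R-equiv i

  euclidean : ∀ α {x y z} → relM M α x y → relM M α x z → relM M α y z
  euclidean α xy xz = Eq.trans (Eq.sym xy) xz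
    where module Eq = IsEquivalence (relM-equiv α)

  modality-intro : ∀ α {w φ} → (∀ x → relM M α w x → _⊨_ M x φ) → _⊨_ M w (modality α φ)
  modality-intro box    h = h
  modality-intro (ag i) h = h

  possibility-intro : ∀ α {w u φ} → relM M α w u → _⊨_ M u φ → _⊨_ M w (possibility α φ)
  possibility-intro box    r h = _ , r , h
  possibility-intro (ag i) r h = _ , r , h

  AtomsHold : (Label → W) → List (RA n) → Set
  AtomsHold I ys = All (λ a → RelHolds M I (rel a)) ys

  sat-rels⁺ : ∀ {I} ys {Γ} → (AtomsHold I ys → SatSeq M I Γ) → SatSeq M I (rels ys ++ Γ)
  sat-rels⁺ ys sat h with AllP.++⁻ (rels ys) h
  ... | hys , hΓ = AnyP.++⁺ʳ (rels ys) (sat (AllP.map⁻ hys) hΓ)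

  sat-rels⁻ : ∀ {I} ys {Γ} → SatSeq M I (rels ys ++ Γ) → AtomsHold I ys → SatSeq M I Γ
  sat-rels⁻ ys sat hys hΓ = drop-rels ys (sat (AllP.++⁺ (AllP.map⁺ hys) hΓ))
    where
    drop-rels : ∀ {I} ys {Γ} → Any (FmHolds M I) (rels ys ++ Γ) → Any (FmHolds M I) Γ
    drop-rels []       p         = p
    drop-rels (_ ∷ ys) (there p) = drop-rels ys p

  euclideanStep : ∀ α {w u v} I → AtomsHold I (mkRA α w u ∷ mkRA α w v ∷ [])
                → AtomsHold I (mkRA α w u ∷ mkRA α w v ∷ mkRA α u v ∷ [])
  euclideanStep α I (wu ∷ wv ∷ []) = wu ∷ wv ∷ euclidean α wu wv ∷ []

  relationalRule : ∀ xs ys Γ → (∀ I → AtomsHold I xs → AtomsHold I ys)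
                 → (∀ I → SatSeq M I (rels ys ++ Γ)) → ∀ I → SatSeq M I (rels xs ++ Γ)
  relationalRule xs ys Γ entails premise I =
    sat-rels⁺ xs λ hxs → sat-rels⁻ ys (premise I) (entails I hxs)

  contracted : ∀ c xs ys → (∀ I → AtomsHold I xs → AtomsHold I ys)
             → ∀ I → AtomsHold I (ctr c xs) → AtomsHold I (ctr c ys)
  contracted c xs ys entails I h = ctr-All⁺ c (entails I (ctr-All⁻ c xs h))

  upd : (Label → W) → Label → W → Label → W
  upd I v a x with x ℕ.≟ v
  ... | yes _ = a
  ... | no _  = I x

  upd-same : ∀ I v a → upd I v a v ≡ a
  upd-same I v a with v ℕ.≟ v
  ... | yes _ = refl
  ... | no v≢v = ⊥-elim (v≢v refl)

  upd-other : ∀ I v a {x} → ¬ (v ≡ x) → upd I v a x ≡ I x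
  upd-other I v a {x} v≢x with x ℕ.≟ v
  ... | yes x≡v = ⊥-elim (v≢x (sym x≡v))
  ... | no _    = refl

  fresh-rel : ∀ {I v a} it → ¬ (v occursIn it) → RelHolds M I it → RelHolds M (upd I v a) it
  fresh-rel (_ ∶ _) _ _ = tt
  fresh-rel {I} {v} {a} (rel (mkRA α x y)) v∉ r =
    subst₂ (relM M α) (sym (upd-other I v a (λ e → v∉ (inj₁ e))))
                      (sym (upd-other I v a (λ e → v∉ (inj₂ e)))) r

  fresh-fm : ∀ {I v a} it → ¬ (v occursIn it) → FmHolds M (upd I v a) it → FmHolds M I it
  fresh-fm {I} {v} {a} (z ∶ φ) v∉ h = subst (λ x → _⊨_ M x φ) (upd-other I v a v∉) h

  fresh-rels : ∀ {I v a Γ} → Fresh v Γ → All (RelHolds M I) Γ → All (RelHolds M (upd I v a)) Γ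
  fresh-rels []         []       = []
  fresh-rels (v∉ ∷ v∉Γ) (h ∷ hΓ) = fresh-rel _ v∉ h ∷ fresh-rels v∉Γ hΓ

  fresh-fms : ∀ {I v a Γ} → Fresh v Γ → Any (FmHolds M (upd I v a)) Γ → Any (FmHolds M I) Γ
  fresh-fms (v∉ ∷ _)   (here h)  = here (fresh-fm _ v∉ h)
  fresh-fms (_ ∷ v∉Γ) (there h) = there (fresh-fms v∉Γ h)

  fresh-sat : ∀ {I v a Γ} → Fresh v Γ → SatSeq M (upd I v a) Γ → SatSeq M I Γ
  fresh-sat v∉Γ sat hΓ = fresh-fms v∉Γ (sat (fresh-rels v∉Γ hΓ))

  freshRelationalRule : ∀ v xs ys Γ → Fresh v Γ
                      → (∀ I → AtomsHold I xs → ∃ λ a → AtomsHold (upd I v a) ys)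
                      → (∀ I → SatSeq M I (rels ys ++ Γ)) → ∀ I → SatSeq M I (rels xs ++ Γ)
  freshRelationalRule v xs ys Γ v∉Γ extends premise I = sat-rels⁺ xs λ hxs →
    let (a , hys) = extends I hxs in fresh-sat v∉Γ (sat-rels⁻ ys (premise (upd I v a)) hys)

  -- Independence of agents (C2): choices u_i available at w always intersect.
  ioa-extension : ∀ w v (u : Fin n → Label) → (∀ i → ¬ (v ≡ w ⊎ v ≡ u i)) → ∀ I
                → AtomsHold I (choicesAt w u)
                → ∃ λ a → AtomsHold (upd I v a) (choicesAt w u ++ meetingAt u v)
  ioa-extension w v u v∉ I hwu = a , AllP.++⁺ (AllP.tabulate⁺ choices) (AllP.tabulate⁺ meet)
    where
    w→u : ∀ i → R□ (I w) (I (u i))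
    w→u = AllP.tabulate⁻ hwu
    intersection : ∃ λ x → ∀ i → R i (I (u i)) x
    intersection = C2 (λ i → I (u i)) (λ i j → euclidean box (w→u i) (w→u j))
    a : W
    a = proj₁ intersection
    choices : ∀ i → R□ (upd I v a w) (upd I v a (u i))
    choices i = fresh-rel (rel (Rb w (u i))) (v∉ i) (w→u i)
    meet : ∀ i → R i (upd I v a (u i)) (upd I v a v)
    meet i = subst₂ (R i) (sym (upd-other I v a (λ e → v∉ i (inj₂ e)))) (sym (upd-same I v a))
                    (proj₂ intersection i)

  idRule : ∀ I Γ w p → SatSeq M I (w ∶ var p ∷ w ∶ nvar p ∷ Γ)
  idRule I Γ w p _ with em {V p (I w)}
  ... | yes p-true  = here p-true
  ... | no  p-false = there (here p-false)

  andRule : ∀ {I} Γ w φ ψ → SatSeq M I (w ∶ φ ∷ Γ) → SatSeq M I (w ∶ ψ ∷ Γ)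
          → SatSeq M I (w ∶ (φ ∧ᶠ ψ) ∷ Γ)
  andRule Γ w φ ψ satφ satψ (_ ∷ hΓ) with satφ (tt ∷ hΓ) | satψ (tt ∷ hΓ)
  ... | here hφ  | here hψ  = here (hφ , hψ)
  ... | there hΓ' | _       = there hΓ'
  ... | here _   | there hΓ' = there hΓ'

  orRule : ∀ {I} Γ w φ ψ → SatSeq M I (w ∶ φ ∷ w ∶ ψ ∷ Γ) → SatSeq M I (w ∶ (φ ∨ᶠ ψ) ∷ Γ)
  orRule Γ w φ ψ sat (_ ∷ hΓ) with sat (tt ∷ tt ∷ hΓ)
  ... | here hφ          = here (inj₁ hφ)
  ... | there (here hψ)  = here (inj₂ hψ)
  ... | there (there hΓ') = there hΓ'

  -- □r and [i]r: either Γ already holds, or (by freshness of v) the premise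
  -- under I[v ↦ x] yields φ at every R_α-successor x of w.
  universalRule : ∀ α w v φ Γ → Fresh v (w ∶ modality α φ ∷ Γ)
                → (∀ J → SatSeq M J (rel (mkRA α w v) ∷ v ∶ φ ∷ Γ))
                → ∀ I → SatSeq M I (w ∶ modality α φ ∷ Γ)
  universalRule α w v φ Γ (v≢w ∷ v∉Γ) premise I (_ ∷ hΓ) with em {Any (FmHolds M I) Γ}
  ... | yes sat = there sat
  ... | no unsat = here (modality-intro α successor)
    where
    relM-upd : ∀ x → relM M α (I w) x → relM M α (upd I v x w) (upd I v x v)
    relM-upd x = subst₂ (relM M α) (sym (upd-other I v x v≢w)) (sym (upd-same I v x))

    successor : ∀ x → relM M α (I w) x → _⊨_ M x φ
    successor x r with premise (upd I v x) (relM-upd x r ∷ tt ∷ fresh-rels v∉Γ hΓ)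
    ... | there (here hφ) = subst (λ y → _⊨_ M y φ) (upd-same I v x) hφ
    ... | there (there sat) = ⊥-elim (unsat (fresh-fms v∉Γ sat))

  existentialRule : ∀ {I} α w u φ Γ
                  → SatSeq M I (rel (mkRA α w u) ∷ w ∶ possibility α φ ∷ u ∶ φ ∷ Γ)
                  → SatSeq M I (rel (mkRA α w u) ∷ w ∶ possibility α φ ∷ Γ)
  existentialRule α w u φ Γ sat (r ∷ _ ∷ hΓ) with sat (r ∷ tt ∷ tt ∷ hΓ)
  ... | there (here h◇)          = there (here h◇)
  ... | there (there (here hφ))  = there (here (possibility-intro α r hφ))
  ... | there (there (there hΓ')) = there (there hΓ')

  -- IOA: the fresh label v of the premise is a point in the intersection of
  -- the choices of the u_i, which C2 provides; duplicates are immaterial.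
  ioaRule : ∀ Γ c w v (u : Fin n → Label)
          → Fresh v (rels (ctr c (choicesAt w u)) ++ Γ)
          → (∀ J → SatSeq M J (rels (ctr c (choicesAt w u ++ meetingAt u v)) ++ Γ))
          → ∀ I → SatSeq M I (rels (ctr c (choicesAt w u)) ++ Γ)
  ioaRule Γ c w v u v∉ premise with AllP.++⁻ (rels (ctr c (choicesAt w u))) v∉
  ... | v∉choices , v∉Γ = freshRelationalRule v _ _ Γ v∉Γ extends premise
    where
    v∉u : ∀ i → ¬ (v ≡ w ⊎ v ≡ u i)
    v∉u = AllP.tabulate⁻ (ctr-All⁻ c _ (AllP.map⁻ v∉choices))
    extends : ∀ I → AtomsHold I (ctr c (choicesAt w u))
            → ∃ λ a → AtomsHold (upd I v a) (ctr c (choicesAt w u ++ meetingAt u v))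
    extends I h with ioa-extension w v u v∉u I (ctr-All⁻ c _ h)
    ... | a , h' = a , ctr-All⁺ c h'

  sound : ∀ Γ → G3 Γ → ∀ I → SatSeq M I Γ
  sound _ (id Γ w p) I = idRule I Γ w p
  sound _ (∧r Γ w φ ψ d e) I = andRule Γ w φ ψ (sound _ d I) (sound _ e I)
  sound _ (∨r Γ w φ ψ d) I = orRule Γ w φ ψ (sound _ d I)
  sound _ (□r Γ w v φ v∉ d) = universalRule box w v φ Γ v∉ (sound _ d)
  sound _ ([i]r Γ i w v φ v∉ d) = universalRule (ag i) w v φ Γ v∉ (sound _ d)
  sound _ (◇r Γ w u φ d) I = existentialRule box w u φ Γ (sound _ d I)
  sound _ (⟨i⟩r Γ i w u φ d) I = existentialRule (ag i) w u φ Γ (sound _ d I)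
  sound _ (refl□ Γ w d) =
    relationalRule [] (Rb w w ∷ []) Γ (λ _ _ → IsEquivalence.refl (relM-equiv box) ∷ []) (sound _ d)
  sound _ (refl[i] Γ i w d) =
    relationalRule [] (Ri i w w ∷ []) Γ (λ _ _ → IsEquivalence.refl (relM-equiv (ag i)) ∷ []) (sound _ d)
  sound _ (br[i] Γ i w u d) =
    relationalRule (Ri i w u ∷ []) (Rb w u ∷ Ri i w u ∷ []) Γ
      (λ { I (r ∷ []) → C1 i (I w) (I u) r ∷ r ∷ [] }) (sound _ d)
  sound _ (eucl□ Γ c w u v d) =
    relationalRule _ _ Γ (contracted c _ _ (euclideanStep box)) (sound _ d)
  sound _ (eucl[i] Γ c i w u v d) =
    relationalRule _ _ Γ (contracted c _ _ (euclideanStep (ag i))) (sound _ d)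
  sound _ (IOA Γ c w v u v∉ d) = ioaRule Γ c w v u v∉ (sound _ d)
  sound _ (perm Γ Δ Γ↭Δ d) I hΔ = Any-resp-↭ Γ↭Δ (sound _ d I (All-resp-↭ (↭-sym Γ↭Δ) hΔ))

theorem3 : ExcludedMiddle 0ℓ → ∀ (n : ℕ) (Γ : Seq n) → G3 Γ → Valid Γ
theorem3 em n Γ d M I = Soundness.sound em M Γ d I
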